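{- The set $\{l\in\mathbb{Q}_{>0} : m(l)\ge k\}$ of feasible cut lengths has a maximum, and this maximum is an optimal cut length, i.e. it minimizes $c(l)$ over all feasible $l$. (The paper denotes the optimal cut length by $l^\star$ and writes $l^\star=\max\{l\in\mathbb{Q}_{>0}\mid m(l)\ge k\}$.)
   Context: Let $\mathbf{L}=\{L_1,\dots,L_n\}$ be a multiset of positive rationals and $k\in\mathbb{N}_{>0}$. For $l\in\mathbb{Q}_{>0}$ define $m(l)=\sum_{i=1}^n\lfloor L_i/l\rfloor$ and $c(l)=\sum_{i=1}^n(\lceil L_i/l\rceil-1)$. A cut length $l$ is feasible if $m(l)\ge k$; an optimal cut length is a feasible $l$ minimizing $c(l)$ among feasible cut lengths. -}

module Defs where

open import Data.List using (List; map; sum)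
open import Data.List.Relation.Unary.All using (All)
open import Data.Integer as ℤ using (ℤ)
open import Data.Rational using (ℚ; Positive; floor; ceiling; _÷_)
open import Data.Rational.Properties using (pos⇒nonZero)
open import Data.Nat using (ℕ)
open import Data.Product using (Σ)

-- A multiset of positive rationals, represented as a list with all entries positive.
PosMultiset : Set
PosMultiset = List ℚ

AllPositive : List ℚ → Set
AllPositive L = All Positive L

m : List ℚ → (l : ℚ) → Positive l → ℤ
m L l lpos = ℤsum (map (λ x → floor (_÷_ x l {{pos⇒nonZero l {{lpos}}}})) L)
  where
  ℤsum : List ℤ → ℤ
  ℤsum = Data.List.foldr ℤ._+_ (ℤ.+ 0)

c : List ℚ → (l : ℚ) → Positive l → ℤ
c L l lpos = ℤsum (map (λ x → ceiling (_÷_ x l {{pos⇒nonZero l {{lpos}}}}) ℤ.- ℤ.+ 1) L)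
  where
  ℤsum : List ℤ → ℤ
  ℤsum = Data.List.foldr ℤ._+_ (ℤ.+ 0)

Feasible : List ℚ → ℕ → ℚ → Set
Feasible L k l = Σ (Positive l) (λ lpos → ℤ.+ k ℤ.≤ m L l lpos)

Optimal : List ℚ → ℕ → ℚ → Set
Optimal L k l = Σ (Feasible L k l) (λ f →
  (l' : ℚ) → (f' : Feasible L k l') → c L l (Σ.proj₁ f) ℤ.≤ c L l' (Σ.proj₁ f'))

-- Since ⌊x / l⌋ ≥ j iff l ≤ x / j, and capping every summand of m(l) at k does not change
-- whether the sum reaches k, m(l) ≥ k holds iff at least k of the candidate lengths L_i / j
-- (1 ≤ j ≤ k, counted with multiplicity) are ≥ l. Feasibility of l thus depends only on which
-- candidates lie above l: raising a feasible l to the least candidate above it keeps it feasible,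
-- so the largest feasible candidate is the largest feasible length. As c is antitone, it is optimal.

module Submission where

open import Data.Empty using (⊥-elim)
open import Data.Integer as ℤ using (ℤ; +_; +[1+_])
import Data.Integer.DivMod as ℤ
import Data.Integer.Properties as ℤ
open import Data.List using (List; []; _∷_; _++_; map; downFrom; concatMap; filter; length)
open import Data.List.Membership.Propositional using (_∈_)
open import Data.List.Membership.Propositional.Properties using (∈-filter⁺; ∈-filter⁻)
import Data.List.Properties as List
open import Data.List.Relation.Unary.All as All using (All; []; _∷_)
open import Data.List.Relation.Unary.All.Properties using (all-filter)
open import Data.List.Relation.Unary.Any using (here; there)
open import Data.Nat as ℕ using (ℕ; zero; suc; _⊓_; _≥_; z≤n; s≤s)
open import Data.Nat.Coprimality using (Coprime; 1-coprimeTo) renaming (sym to coprime-sym)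
open import Data.Nat.ListAction using (sum)
import Data.Nat.Properties as ℕ
open import Data.Product using (Σ; ∃-syntax; _×_; _,_; proj₁; proj₂)
open import Data.Rational as ℚ using (ℚ; mkℚ; _≤_; _*_; 1/_; Positive; NonNegative; _÷_; floor; ceiling)
open import Data.Rational.Properties using (_≤?_; _<?_)
import Data.Rational.Properties as ℚ
open import Data.Sum using (inj₁; inj₂)
open import Function using (id)
open import Function.Bundles using (_⇔_; mk⇔; Equivalence)
open import Level using (Level)
open import Relation.Binary.Bundles using (DecTotalOrder)
open import Relation.Binary.PropositionalEquality
  using (_≡_; _≢_; refl; sym; trans; cong; cong₂; subst; module ≡-Reasoning)
open import Relation.Nullary using (yes; no; contradiction)
open import Relation.Unary using (Pred; Decidable)

open import Data.List.Extrema (DecTotalOrder.totalOrder ℚ.≤-decTotalOrder)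
  using (min; max; argmin-sel; min≤⊤; min≤xs; argmax-all; xs≤max)

open import Defs

private variable
  a ℓ ℓ′ : Level
  A : Set a

-- z / 1 without normalisation, so that floor and _≤_ compute on it.
fromℤ : ℤ → ℚ
fromℤ z = mkℚ z 0 (coprime-sym (1-coprimeTo _))

floor-mkℚ : ∀ n d .{c : Coprime ℤ.∣ n ∣ (suc d)} → floor (mkℚ n d c) ≡ n ℤ./ℕ suc d
floor-mkℚ n d = ℤ.div-pos-is-/ℕ n (suc d)

≤floor⇒≤ : ∀ {z q} → z ℤ.≤ floor q → fromℤ z ≤ q
≤floor⇒≤ {z} {mkℚ n d c} z≤⌊q⌋ rewrite floor-mkℚ n d {c} = ℚ.*≤* (begin
  z ℤ.* + suc d                ≤⟨ ℤ.*-monoʳ-≤-nonNeg (+ suc d) z≤⌊q⌋ ⟩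
  (n ℤ./ℕ suc d) ℤ.* + suc d   ≤⟨ ℤ.[n/ℕd]*d≤n n (suc d) ⟩
  n                            ≡⟨ ℤ.*-identityʳ n ⟨
  n ℤ.* + 1                    ∎)
  where open ℤ.≤-Reasoning

≤⇒≤floor : ∀ {z q} → fromℤ z ≤ q → z ℤ.≤ floor q
≤⇒≤floor {z} {mkℚ n d c} (ℚ.*≤* z*d≤n) rewrite floor-mkℚ n d {c} with z ℤ.≤? n ℤ./ℕ suc d
... | yes z≤⌊q⌋ = z≤⌊q⌋
... | no z≰⌊q⌋ = contradiction (ℤ.≤-<-trans (ℤ.≤-trans
    (ℤ.*-monoʳ-≤-nonNeg (+ suc d) (ℤ.i<j⇒suc[i]≤j (ℤ.≰⇒> z≰⌊q⌋)))
    (ℤ.≤-trans z*d≤n (ℤ.≤-reflexive (ℤ.*-identityʳ n))))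
    (ℤ.n<s[n/ℕd]*d n (suc d))) (ℤ.<-irrefl refl)

floor-mono : ∀ {p q} → p ≤ q → floor p ℤ.≤ floor q
floor-mono {p} p≤q = ≤⇒≤floor (ℚ.≤-trans (≤floor⇒≤ (ℤ.≤-refl {floor p})) p≤q)

ceiling-mono : ∀ {p q} → p ≤ q → ceiling p ℤ.≤ ceiling q
ceiling-mono {mkℚ _ _ _} {mkℚ _ _ _} p≤q = ℤ.neg-mono-≤ (floor-mono (ℚ.neg-antimono-≤ p≤q))

_÷⁺_ : ℚ → (r : ℚ) → .{{Positive r}} → ℚ
x ÷⁺ r = _÷_ x r {{ℚ.pos⇒nonZero r}}

÷⁺-*-inverse : ∀ x r .{{_ : Positive r}} → (x ÷⁺ r) * r ≡ x
÷⁺-*-inverse x r = begin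
  (x * 1/ r) * r    ≡⟨ ℚ.*-assoc x (1/ r) r ⟩
  x * (1/ r * r)    ≡⟨ cong (x *_) (ℚ.*-inverseˡ r) ⟩
  x * ℚ.1ℚ          ≡⟨ ℚ.*-identityʳ x ⟩
  x                 ∎
  where
  open ≡-Reasoning
  instance _ = ℚ.pos⇒nonZero r

≤÷⁺⇒*≤ : ∀ {p x} r .{{_ : Positive r}} → p ≤ x ÷⁺ r → p * r ≤ x
≤÷⁺⇒*≤ {p} {x} r p≤x/r =
  ℚ.≤-trans (ℚ.*-monoʳ-≤-nonNeg r {{ℚ.pos⇒nonNeg r}} p≤x/r) (ℚ.≤-reflexive (÷⁺-*-inverse x r))

*≤⇒≤÷⁺ : ∀ {p x} r .{{_ : Positive r}} → p * r ≤ x → p ≤ x ÷⁺ r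
*≤⇒≤÷⁺ {p} {x} r pr≤x = ℚ.*-cancelʳ-≤-pos r (ℚ.≤-trans pr≤x (ℚ.≤-reflexive (sym (÷⁺-*-inverse x r))))

≤÷⁺-swap : ∀ x p q .{{_ : Positive p}} .{{_ : Positive q}} → p ≤ x ÷⁺ q → q ≤ x ÷⁺ p
≤÷⁺-swap x p q p≤x/q = *≤⇒≤÷⁺ p (subst (_≤ x) (ℚ.*-comm p q) (≤÷⁺⇒*≤ q p≤x/q))

÷⁺-nonNeg : ∀ x .{{_ : NonNegative x}} r .{{_ : Positive r}} → NonNegative (x ÷⁺ r)
÷⁺-nonNeg x r = ℚ.nonNeg*nonNeg⇒nonNeg x (1/_ r {{ℚ.pos⇒nonZero r}})
  {{ℚ.pos⇒nonNeg (1/_ r {{ℚ.pos⇒nonZero r}}) {{ℚ.1/pos⇒pos r}}}}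

÷⁺-pos : ∀ x .{{_ : Positive x}} r .{{_ : Positive r}} → Positive (x ÷⁺ r)
÷⁺-pos x r = ℚ.pos*pos⇒pos x (1/_ r {{ℚ.pos⇒nonZero r}}) {{ℚ.1/pos⇒pos r}}

÷⁺-antitone : ∀ x .{{_ : NonNegative x}} p q .{{_ : Positive p}} .{{_ : Positive q}} → p ≤ q → x ÷⁺ q ≤ x ÷⁺ p
÷⁺-antitone x p q p≤q = *≤⇒≤÷⁺ p (ℚ.≤-trans
  (ℚ.*-monoˡ-≤-nonNeg (x ÷⁺ q) {{÷⁺-nonNeg x q}} p≤q)
  (ℚ.≤-reflexive (÷⁺-*-inverse x q)))

floor-nonNeg : ∀ q .{{_ : NonNegative q}} → + 0 ℤ.≤ floor q
floor-nonNeg q = ≤⇒≤floor (ℚ.nonNegative⁻¹ q)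

pieces : (x l : ℚ) .{{_ : Positive l}} → ℕ
pieces x l = ℤ.∣ floor (x ÷⁺ l) ∣

+pieces≡floor : ∀ x .{{_ : NonNegative x}} l .{{_ : Positive l}} → + pieces x l ≡ floor (x ÷⁺ l)
+pieces≡floor x l = ℤ.0≤i⇒+∣i∣≡i (floor-nonNeg (x ÷⁺ l) {{÷⁺-nonNeg x l}})

1+j≤pieces⇔≤÷⁺1+j : ∀ x .{{_ : NonNegative x}} l .{{_ : Positive l}} j →
                     suc j ℕ.≤ pieces x l ⇔ l ≤ x ÷⁺ fromℤ +[1+ j ]
1+j≤pieces⇔≤÷⁺1+j x l j = mk⇔
  (λ 1+j≤n → ≤÷⁺-swap x (fromℤ +[1+ j ]) l
    (≤floor⇒≤ (subst (+[1+ j ] ℤ.≤_) (+pieces≡floor x l) (ℤ.+≤+ 1+j≤n))))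
  (λ l≤x/j → ℤ.drop‿+≤+ (subst (+[1+ j ] ℤ.≤_) (sym (+pieces≡floor x l))
    (≤⇒≤floor (≤÷⁺-swap x l (fromℤ +[1+ j ]) l≤x/j))))

m≡sum-pieces : ∀ {L} → AllPositive L → ∀ l (lp : Positive l) → m L l lp ≡ + sum (map (λ x → pieces x l {{lp}}) L)
m≡sum-pieces [] l lp = refl
m≡sum-pieces {x ∷ L} (x>0 ∷ L>0) l lp =
  cong₂ ℤ._+_ (sym (+pieces≡floor x {{ℚ.pos⇒nonNeg x {{x>0}}}} l {{lp}})) (m≡sum-pieces L>0 l lp)

filter-length-mono : ∀ {P : Pred A ℓ} {Q : Pred A ℓ′} (P? : Decidable P) (Q? : Decidable Q) {xs} →
                     All (λ x → P x → Q x) xs → length (filter P? xs) ℕ.≤ length (filter Q? xs)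
filter-length-mono P? Q? [] = z≤n
filter-length-mono P? Q? {x ∷ xs} (P⇒Q ∷ hs) with P? x | Q? x
... | yes Px | yes _  = s≤s (filter-length-mono P? Q? hs)
... | yes Px | no ¬Qx = contradiction (P⇒Q Px) ¬Qx
... | no _   | yes _  = ℕ.m≤n⇒m≤1+n (filter-length-mono P? Q? hs)
... | no _   | no _   = filter-length-mono P? Q? hs

[m+n]⊓o≤m⊓o+n⊓o : ∀ m n o → (m ℕ.+ n) ⊓ o ℕ.≤ m ⊓ o ℕ.+ n ⊓ o
[m+n]⊓o≤m⊓o+n⊓o m n o with m ℕ.≤? o
... | yes m≤o = begin
  (m ℕ.+ n) ⊓ o          ≤⟨ ℕ.⊓-monoʳ-≤ (m ℕ.+ n) (ℕ.m≤n+m o m) ⟩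
  (m ℕ.+ n) ⊓ (m ℕ.+ o)  ≡⟨ ℕ.+-distribˡ-⊓ m n o ⟨
  m ℕ.+ n ⊓ o            ≡⟨ cong (ℕ._+ n ⊓ o) (ℕ.m≤n⇒m⊓n≡m m≤o) ⟨
  m ⊓ o ℕ.+ n ⊓ o        ∎
  where open ℕ.≤-Reasoning
... | no m≰o = begin
  (m ℕ.+ n) ⊓ o          ≤⟨ ℕ.m⊓n≤n (m ℕ.+ n) o ⟩
  o                      ≤⟨ ℕ.m≤m+n o (n ⊓ o) ⟩
  o ℕ.+ n ⊓ o            ≡⟨ cong (ℕ._+ n ⊓ o) (ℕ.m≥n⇒m⊓n≡n (ℕ.<⇒≤ (ℕ.≰⇒> m≰o))) ⟨
  m ⊓ o ℕ.+ n ⊓ o        ∎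
  where open ℕ.≤-Reasoning

sum⊓≤sum-map⊓ : ∀ (f : A → ℕ) k xs → sum (map f xs) ⊓ k ℕ.≤ sum (map (λ x → f x ⊓ k) xs)
sum⊓≤sum-map⊓ f k [] = z≤n
sum⊓≤sum-map⊓ f k (x ∷ xs) = ℕ.≤-trans ([m+n]⊓o≤m⊓o+n⊓o (f x) (sum (map f xs)) k)
  (ℕ.+-monoʳ-≤ (f x ⊓ k) (sum⊓≤sum-map⊓ f k xs))

sum-map⊓≤sum : ∀ (f : A → ℕ) k xs → sum (map (λ x → f x ⊓ k) xs) ℕ.≤ sum (map f xs)
sum-map⊓≤sum f k [] = z≤n
sum-map⊓≤sum f k (x ∷ xs) = ℕ.+-mono-≤ (ℕ.m⊓n≤m (f x) k) (sum-map⊓≤sum f k xs)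

≤sum⇔≤sum-map⊓ : ∀ (f : A → ℕ) k xs → k ℕ.≤ sum (map f xs) ⇔ k ℕ.≤ sum (map (λ x → f x ⊓ k) xs)
≤sum⇔≤sum-map⊓ f k xs = mk⇔
  (λ k≤Σ → ℕ.≤-trans (ℕ.≤-reflexive (sym (ℕ.m≥n⇒m⊓n≡n k≤Σ))) (sum⊓≤sum-map⊓ f k xs))
  (λ k≤Σ⊓ → ℕ.≤-trans k≤Σ⊓ (sum-map⊓≤sum f k xs))

pieceCandidates : ℕ → ℚ → List ℚ
pieceCandidates k x = map (λ j → x ÷⁺ fromℤ +[1+ j ]) (downFrom k)

candidates : ℕ → List ℚ → List ℚ
candidates k = concatMap (pieceCandidates k)

countAbove : ℚ → List ℚ → ℕ
countAbove l xs = length (filter (l ≤?_) xs)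

countAbove-++ : ∀ l xs ys → countAbove l (xs ++ ys) ≡ countAbove l xs ℕ.+ countAbove l ys
countAbove-++ l xs ys = trans (cong length (List.filter-++ (l ≤?_) xs ys)) (List.length-++ (filter (l ≤?_) xs))

countAbove-pieceCandidates : ∀ k x .{{_ : NonNegative x}} l .{{_ : Positive l}} →
                             countAbove l (pieceCandidates k x) ≡ pieces x l ⊓ k
countAbove-pieceCandidates zero x l = sym (ℕ.⊓-zeroʳ (pieces x l))
countAbove-pieceCandidates (suc k) x l with l ≤? x ÷⁺ fromℤ +[1+ k ]
... | yes l≤x/k+1 = begin
  countAbove l (pieceCandidates (suc k) x) ≡⟨ cong length (List.filter-accept (l ≤?_) l≤x/k+1) ⟩
  suc (countAbove l (pieceCandidates k x)) ≡⟨ cong suc (countAbove-pieceCandidates k x l) ⟩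
  suc (pieces x l ⊓ k)                     ≡⟨ cong suc (ℕ.m≥n⇒m⊓n≡n (ℕ.<⇒≤ k<n)) ⟩
  suc k                                    ≡⟨ ℕ.m≥n⇒m⊓n≡n k<n ⟨
  pieces x l ⊓ suc k                       ∎
  where
  open ≡-Reasoning
  k<n = Equivalence.from (1+j≤pieces⇔≤÷⁺1+j x l k) l≤x/k+1
... | no l≰x/k+1 = begin
  countAbove l (pieceCandidates (suc k) x) ≡⟨ cong length (List.filter-reject (l ≤?_) l≰x/k+1) ⟩
  countAbove l (pieceCandidates k x) ≡⟨ countAbove-pieceCandidates k x l ⟩
  pieces x l ⊓ k                     ≡⟨ ℕ.m≤n⇒m⊓n≡m n≤k ⟩
  pieces x l                         ≡⟨ ℕ.m≤n⇒m⊓n≡m (ℕ.m≤n⇒m≤1+n n≤k) ⟨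
  pieces x l ⊓ suc k                 ∎
  where
  open ≡-Reasoning
  n≤k = ℕ.≮⇒≥ (λ k<n → l≰x/k+1 (Equivalence.to (1+j≤pieces⇔≤÷⁺1+j x l k) k<n))

countAbove-candidates : ∀ k {L} → AllPositive L → ∀ l (lp : Positive l) →
                        countAbove l (candidates k L) ≡ sum (map (λ x → pieces x l {{lp}} ⊓ k) L)
countAbove-candidates k [] l lp = refl
countAbove-candidates k {x ∷ L} (x>0 ∷ L>0) l lp = begin
  countAbove l (pieceCandidates k x ++ candidates k L)            ≡⟨ countAbove-++ l (pieceCandidates k x) (candidates k L) ⟩
  countAbove l (pieceCandidates k x) ℕ.+ countAbove l (candidates k L)
    ≡⟨ cong₂ ℕ._+_ (countAbove-pieceCandidates k x {{ℚ.pos⇒nonNeg x {{x>0}}}} l {{lp}}) (countAbove-candidates k L>0 l lp) ⟩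
  pieces x l {{lp}} ⊓ k ℕ.+ sum (map (λ x → pieces x l {{lp}} ⊓ k) L) ∎
  where open ≡-Reasoning

feasible⇔k≤countAbove : ∀ {L} → AllPositive L → ∀ k l (lp : Positive l) →
                        + k ℤ.≤ m L l lp ⇔ k ℕ.≤ countAbove l (candidates k L)
feasible⇔k≤countAbove {L} L>0 k l lp
  rewrite m≡sum-pieces L>0 l lp | countAbove-candidates k L>0 l lp = mk⇔
  (λ k≤m → Equivalence.to (≤sum⇔≤sum-map⊓ (λ x → pieces x l {{lp}}) k L) (ℤ.drop‿+≤+ k≤m))
  (λ k≤N → ℤ.+≤+ (Equivalence.from (≤sum⇔≤sum-map⊓ (λ x → pieces x l {{lp}}) k L) k≤N))

min∈ : ∀ y ys → min y ys ∈ y ∷ ys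
min∈ y ys with argmin-sel id y ys
... | inj₁ min≡y  = here min≡y
... | inj₂ min∈ys = there min∈ys

leastAbove : ∀ l xs → 0 ℕ.< countAbove l xs →
             ∃[ d ] d ∈ xs × l ≤ d × countAbove l xs ℕ.≤ countAbove d xs
leastAbove l xs 0<N with filter (l ≤?_) xs in above≡ | 0<N
... | y ∷ ys | _ = d , d∈xs , l≤d ,
  subst (λ zs → length zs ℕ.≤ countAbove d xs) above≡ (filter-length-mono (l ≤?_) (d ≤?_) (All.tabulate d≤above))
  where
  d = min y ys
  d∈above : d ∈ filter (l ≤?_) xs
  d∈above = subst (d ∈_) (sym above≡) (min∈ y ys)
  d∈xs = proj₁ (∈-filter⁻ (l ≤?_) {xs = xs} d∈above)
  l≤d = proj₂ (∈-filter⁻ (l ≤?_) {xs = xs} d∈above)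
  d≤above : ∀ {e} → e ∈ xs → l ≤ e → d ≤ e
  d≤above e∈xs l≤e =
    All.lookup (min≤⊤ y ys ∷ min≤xs y ys) (subst (_ ∈_) above≡ (∈-filter⁺ (l ≤?_) e∈xs l≤e))

c-antitone : ∀ {L} → AllPositive L → ∀ {l l'} (lp : Positive l) (lp' : Positive l') → l ≤ l' → c L l' lp' ℤ.≤ c L l lp
c-antitone [] lp lp' l≤l' = ℤ.≤-refl
c-antitone {x ∷ L} (x>0 ∷ L>0) {l} {l'} lp lp' l≤l' = ℤ.+-mono-≤
  (ℤ.+-monoˡ-≤ (ℤ.- + 1) (ceiling-mono (÷⁺-antitone x {{ℚ.pos⇒nonNeg x {{x>0}}}} l l' {{lp}} {{lp'}} l≤l')))
  (c-antitone L>0 lp lp' l≤l')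

feasible? : ∀ L k → Decidable (Feasible L k)
feasible? L k l with ℚ.0ℚ <? l
... | no l≯0 = no (λ (lp , _) → l≯0 (ℚ.positive⁻¹ l {{lp}}))
-- m uses its positivity proof only inside an irrelevant instance, so any proof will do.
... | yes l>0 with + k ℤ.≤? m L l (ℚ.positive l>0)
...   | yes k≤m = yes (ℚ.positive l>0 , k≤m)
...   | no k≰m  = no (λ (_ , k≤m) → k≰m k≤m)

feasible⇒≤feasibleCandidate : ∀ {L k l} → AllPositive L → 1 ℕ.≤ k → Feasible L k l →
                              ∃[ d ] d ∈ candidates k L × l ≤ d × Feasible L k d
feasible⇒≤feasibleCandidate {L} {k} {l} L>0 k≥1 (lp , k≤m) =
  let d , d∈ , l≤d , N≤N′ = leastAbove l (candidates k L) (ℕ.<-≤-trans k≥1 k≤N)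
      dp = ℚ.positive (ℚ.<-≤-trans (ℚ.positive⁻¹ l {{lp}}) l≤d)
  in d , d∈ , l≤d , dp , Equivalence.from (feasible⇔k≤countAbove L>0 k d dp) (ℕ.≤-trans k≤N N≤N′)
  where k≤N = Equivalence.to (feasible⇔k≤countAbove L>0 k l lp) k≤m

first÷k-feasible : ∀ {x L} → AllPositive (x ∷ L) → ∀ k →
                        Feasible (x ∷ L) (suc k) (x ÷⁺ fromℤ +[1+ k ])
first÷k-feasible {x} {L} L>0@(x>0 ∷ _) k = dp , Equivalence.from (feasible⇔k≤countAbove L>0 (suc k) d dp) (begin
  suc k                                                ≡⟨ ℕ.m≥n⇒m⊓n≡n k<n ⟨
  pieces x d ⊓ suc k                                   ≡⟨ countAbove-pieceCandidates (suc k) x d ⟨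
  countAbove d (pieceCandidates (suc k) x)             ≤⟨ ℕ.m≤m+n _ _ ⟩
  countAbove d (pieceCandidates (suc k) x) ℕ.+ countAbove d (candidates (suc k) L)
                                                       ≡⟨ countAbove-++ d (pieceCandidates (suc k) x) (candidates (suc k) L) ⟨
  countAbove d (candidates (suc k) (x ∷ L))            ∎)
  where
  open ℕ.≤-Reasoning
  instance
    _ = x>0
    _ = ℚ.pos⇒nonNeg x
    dp = ÷⁺-pos x (fromℤ +[1+ k ])
  d = x ÷⁺ fromℤ +[1+ k ]
  k<n = Equivalence.from (1+j≤pieces⇔≤÷⁺1+j x d k) ℚ.≤-refl

feasible-maximum : ∀ {L} → L ≢ [] → AllPositive L → ∀ k → k ≥ 1 →
                   Σ ℚ λ l⋆ → Feasible L k l⋆ × (∀ l → Feasible L k l → l ≤ l⋆)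
feasible-maximum {[]} L≢[] = ⊥-elim (L≢[] refl)
feasible-maximum {L@(x ∷ _)} _ L>0 k@(suc k-1) k≥1 = l⋆ , l⋆-feasible , l⋆-maximal
  where
  feasibleCandidates = filter (feasible? L k) (candidates k L)
  l⋆ = max (x ÷⁺ fromℤ +[1+ k-1 ]) feasibleCandidates
  l⋆-feasible : Feasible L k l⋆
  l⋆-feasible = argmax-all id (first÷k-feasible L>0 k-1) (all-filter (feasible? L k) (candidates k L))
  l⋆-maximal : ∀ l → Feasible L k l → l ≤ l⋆
  l⋆-maximal l l-feasible =
    let d , d∈ , l≤d , d-feasible = feasible⇒≤feasibleCandidate L>0 k≥1 l-feasible
    in ℚ.≤-trans l≤d (All.lookup (xs≤max _ feasibleCandidates) (∈-filter⁺ (feasible? L k) d∈ d-feasible))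

corollary1 : (L : List ℚ) → L ≢ [] → AllPositive L → (k : ℕ) → k ≥ 1 →
    Σ ℚ (λ lstar → (Feasible L k lstar × ((l : ℚ) → Feasible L k l → l ≤ lstar)) × Optimal L k lstar)
corollary1 L L≢[] L>0 k k≥1 =
  let l⋆ , l⋆-feasible , l⋆-maximal = feasible-maximum L≢[] L>0 k k≥1
  in l⋆ , (l⋆-feasible , l⋆-maximal) ,
     (l⋆-feasible , λ l l-feasible → c-antitone L>0 (proj₁ l-feasible) (proj₁ l⋆-feasible) (l⋆-maximal l l-feasible))
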